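{- Let $k\geq 0$ and $n\geq 1$ be integers. For $q=0,\ldots,2(n-1)$ let $C_{2,q}(n)$ denote the coefficient of $a^{q+2}$ in the polynomial $\left(\sum_{i=0}^{n-1}a^{i+1}\right)^2$. Define \[ s_{k,1}(n)=\sum_{q=1}^{n}q^{2k+1},\qquad s_{k,2}(n)=\sum_{q=0}^{2n-2}C_{2,q}(n)\,(q+2)^{2k+1}, \] \[ S_{k,2}(n)=s_{k,2}(n)+\binom{2(n+1)}{1}s_{k,1}(n), \] and \[ \tilde{S}_{k,2}(n)=\sum_{\substack{(\lambda_1,\lambda_2)\in\mathbb{Z}^2\\ 1\leq\lambda_1\leq\lambda_2\leq 2n}}\left(\lambda_1^{2k+1}+(\lambda_2-n)^{2k+1}\right), \] where $(\lambda_2-n)^{2k+1}$ is the ordinary (possibly negative) odd power. Then $\tilde{S}_{k,2}(n)=S_{k,2}(n)$. -}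

module Defs where

open import Data.Nat as ℕ using (ℕ; zero; suc)
open import Data.Integer as ℤ using (ℤ; +_; _-_; _+_; _*_; _^_)
open import Data.List using (List; []; _∷_; replicate; _++_)
open import Data.Nat.Combinatorics using (_C_)

-- Polynomials with natural-number coefficients, as coefficient lists
-- (the i-th entry is the coefficient of a^i).
Poly : Set
Poly = List ℕ

_⊕_ : Poly → Poly → Poly
[] ⊕ q = q
(x ∷ p) ⊕ [] = x ∷ p
(x ∷ p) ⊕ (y ∷ q) = (x ℕ.+ y) ∷ (p ⊕ q)

scale : ℕ → Poly → Poly
scale c [] = []
scale c (x ∷ p) = (c ℕ.* x) ∷ scale c p

_⊗_ : Poly → Poly → Poly
[] ⊗ q = []
(x ∷ p) ⊗ q = scale x q ⊕ (0 ∷ (p ⊗ q))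

coeff : Poly → ℕ → ℕ
coeff [] i = 0
coeff (x ∷ p) zero = x
coeff (x ∷ p) (suc i) = coeff p i

mono : ℕ → Poly
mono d = replicate d 0 ++ (1 ∷ [])

sumℤ : ℕ → (ℕ → ℤ) → ℤ
sumℤ zero f = + 0
sumℤ (suc m) f = sumℤ m f + f m

sumPoly : ℕ → (ℕ → Poly) → Poly
sumPoly zero f = []
sumPoly (suc m) f = sumPoly m f ⊕ f m

basePoly : ℕ → Poly
basePoly n = sumPoly n (λ i → mono (suc i))

C₂ : ℕ → ℕ → ℕ
C₂ n q = coeff (basePoly n ⊗ basePoly n) (q ℕ.+ 2)

s₁ : ℕ → ℕ → ℤ
s₁ k n = sumℤ n (λ i → (+ suc i) ^ (2 ℕ.* k ℕ.+ 1))

s₂ : ℕ → ℕ → ℤ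
s₂ k n = sumℤ (2 ℕ.* n ℕ.∸ 1) (λ q → (+ C₂ n q) * ((+ (q ℕ.+ 2)) ^ (2 ℕ.* k ℕ.+ 1)))

S₂ : ℕ → ℕ → ℤ
S₂ k n = s₂ k n + (+ ((2 ℕ.* (n ℕ.+ 1)) C 1)) * s₁ k n

-- S̃_{k,2}(n) = Σ_{1 ≤ λ₁ ≤ λ₂ ≤ 2n} (λ₁^{2k+1} + (λ₂ - n)^{2k+1}), computed in ℤ.
-- Outer index j < 2n gives λ₂ = j+1; inner index i < j+1 gives λ₁ = i+1.
S̃₂ : ℕ → ℕ → ℤ
S̃₂ k n = sumℤ (2 ℕ.* n) (λ j → sumℤ (suc j) (λ i →
           ((+ suc i) ^ (2 ℕ.* k ℕ.+ 1)) + ((+ suc j - + n) ^ (2 ℕ.* k ℕ.+ 1))))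

module Submission where

open import Defs
open import Data.Nat using (ℕ; _≥_)
open import Relation.Binary.PropositionalEquality using (_≡_)

open import Data.Nat as ℕ using (zero; suc; s≤s; _∸_; _<_; _≤_)
import Data.Nat.Properties as ℕP
open import Data.Integer using (ℤ; +_; -_; _-_; _+_; _*_; _^_)
import Data.Integer.Properties as ℤP
open import Data.Integer.Tactic.RingSolver using (solve-∀)
open import Relation.Binary.PropositionalEquality
  using (refl; sym; trans; cong; cong₂; module ≡-Reasoning)
open import Data.List using ([]; _∷_)
open import Data.Nat.Combinatorics using (_C_; nC1≡n)

-- Write e = 2k+1, P t = t^e and n = m+1.  Both sides are
-- brought to the normal form
--     Σ_{i<n} ( (2n+2+i) · P(i+1)  +  (n-i) · P(n+i+1) ).
-- Left side: the inner sum of S̃ splits into Σ_{i≤j} P(i+1) and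
-- (j+1)·(j+1-n)^e; exchanging the triangular double sum gives weights 2n-t,
-- and reversing the indices j < n turns their contribution, e being odd,
-- into -(n-1-i)·P(i+1).
-- Right side: C₂(n,q) counts pairs (a,b) with a,b < n and a+b = q; via the
-- convolution formula for coefficients and a counting ("window") lemma,
-- C₂(n,q) = q+1 for q < n and C₂(n,m+i) = n-i for i ≤ m.

-- Σ_{i<m} f i over ℕ, peeling off the first term: the shape in which the
-- coefficients of a product of coefficient lists unfold.
Σℕ : ℕ → (ℕ → ℕ) → ℕ
Σℕ zero    f = 0
Σℕ (suc m) f = f 0 ℕ.+ Σℕ m (λ i → f (suc i))

Σℕ-cong : ∀ m {f g : ℕ → ℕ} → (∀ i → i < m → f i ≡ g i) → Σℕ m f ≡ Σℕ m g
Σℕ-cong zero    h = refl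
Σℕ-cong (suc m) h =
  cong₂ ℕ._+_ (h 0 (s≤s ℕ.z≤n)) (Σℕ-cong m (λ i i<m → h (suc i) (s≤s i<m)))

Σℕ-zeros : ∀ m {f : ℕ → ℕ} → (∀ i → i < m → f i ≡ 0) → Σℕ m f ≡ 0
Σℕ-zeros m h = trans (Σℕ-cong m h) (zeros m)
  where
  zeros : ∀ m → Σℕ m (λ _ → 0) ≡ 0
  zeros zero    = refl
  zeros (suc m) = zeros m

Σℕ-dropLast : ∀ m {f : ℕ → ℕ} → f m ≡ 0 → Σℕ (suc m) f ≡ Σℕ m f
Σℕ-dropLast zero    {f} fm≡0 = trans (ℕP.+-identityʳ (f 0)) fm≡0
Σℕ-dropLast (suc m) {f} fm≡0 = cong (f 0 ℕ.+_) (Σℕ-dropLast m fm≡0)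

Σℕ-window : ∀ a r c {f : ℕ → ℕ} →
  (∀ i → i < a → f i ≡ 0) →
  (∀ i → i < r → f (a ℕ.+ i) ≡ 1) →
  (∀ i → i < c → f (a ℕ.+ r ℕ.+ i) ≡ 0) →
  Σℕ (a ℕ.+ (r ℕ.+ c)) f ≡ r
Σℕ-window (suc a) r c before inside after =
  cong₂ ℕ._+_ (before 0 (s≤s ℕ.z≤n))
    (Σℕ-window a r c (λ i i<a → before (suc i) (s≤s i<a)) inside after)
Σℕ-window zero (suc r) c before inside after =
  cong₂ ℕ._+_ (inside 0 (s≤s ℕ.z≤n))
    (Σℕ-window zero r c (λ _ ()) (λ i i<r → inside (suc i) (s≤s i<r)) after)
Σℕ-window zero zero c before inside after = Σℕ-zeros c after

coeff-⊕ : ∀ p q i → coeff (p ⊕ q) i ≡ coeff p i ℕ.+ coeff q i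
coeff-⊕ []      q       i       = refl
coeff-⊕ (x ∷ p) []      i       = sym (ℕP.+-identityʳ _)
coeff-⊕ (x ∷ p) (y ∷ q) zero    = refl
coeff-⊕ (x ∷ p) (y ∷ q) (suc i) = coeff-⊕ p q i

coeff-scale : ∀ c p i → coeff (scale c p) i ≡ c ℕ.* coeff p i
coeff-scale c []      i       = sym (ℕP.*-zeroʳ c)
coeff-scale c (x ∷ p) zero    = refl
coeff-scale c (x ∷ p) (suc i) = coeff-scale c p i

coeff-⊗ : ∀ p q i →
  coeff (p ⊗ q) i ≡ Σℕ (suc i) (λ j → coeff p j ℕ.* coeff q (i ∸ j))
coeff-⊗ []      q i       = sym (Σℕ-zeros (suc i) (λ _ _ → refl))
coeff-⊗ (x ∷ p) q zero    =
  trans (coeff-⊕ (scale x q) (0 ∷ (p ⊗ q)) 0) (cong (ℕ._+ 0) (coeff-scale x q 0))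
coeff-⊗ (x ∷ p) q (suc i) =
  trans (coeff-⊕ (scale x q) (0 ∷ (p ⊗ q)) (suc i))
        (cong₂ ℕ._+_ (coeff-scale x q (suc i)) (coeff-⊗ p q i))

below : ℕ → ℕ → ℕ
below i       zero    = 0
below zero    (suc n) = 1
below (suc i) (suc n) = below i n

below-1 : ∀ {j n} → j < n → below j n ≡ 1
below-1 {zero}  {suc n} _         = refl
below-1 {suc j} {suc n} (s≤s j<n) = below-1 j<n

below-0 : ∀ {j n} → n ≤ j → below j n ≡ 0
below-0 {j}     {zero}  _         = refl
below-0 {suc j} {suc n} (s≤s n≤j) = below-0 n≤j

below-suc : ∀ i n → below i (suc n) ≡ below i n ℕ.+ coeff (mono n) i
below-suc zero    zero    = refl
below-suc zero    (suc n) = refl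
below-suc (suc i) zero    = refl
below-suc (suc i) (suc n) = below-suc i n

baseCoeff : ℕ → ℕ → ℕ
baseCoeff n zero    = 0
baseCoeff n (suc i) = below i n

coeff-basePoly : ∀ n i → coeff (basePoly n) i ≡ baseCoeff n i
coeff-basePoly zero    zero    = refl
coeff-basePoly zero    (suc i) = refl
coeff-basePoly (suc n) i =
  trans (coeff-⊕ (basePoly n) (mono (suc n)) i)
        (trans (cong (ℕ._+ coeff (mono (suc n)) i) (coeff-basePoly n i)) (step i))
  where
  step : ∀ i → baseCoeff n i ℕ.+ coeff (mono (suc n)) i ≡ baseCoeff (suc n) i
  step zero    = refl
  step (suc i) = sym (below-suc i n)

pairCount : ℕ → ℕ → ℕ
pairCount n q = Σℕ (suc q) (λ j → below j n ℕ.* below (q ∸ j) n)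

-- C_{2,q}(n) counts the ways to write a^{q+2} as a^{a+1} · a^{b+1} with a, b < n.
C₂≡pairCount : ∀ n q → C₂ n q ≡ pairCount n q
C₂≡pairCount n q = begin
  coeff (B ⊗ B) (q ℕ.+ 2)
    ≡⟨ cong (coeff (B ⊗ B)) (ℕP.+-comm q 2) ⟩
  coeff (B ⊗ B) (2 ℕ.+ q)
    ≡⟨ coeff-⊗ B B (2 ℕ.+ q) ⟩
  Σℕ (3 ℕ.+ q) (λ j → coeff B j ℕ.* coeff B (2 ℕ.+ q ∸ j))
    ≡⟨ Σℕ-cong (3 ℕ.+ q) (λ j _ →
         cong₂ ℕ._*_ (coeff-basePoly n j) (coeff-basePoly n (2 ℕ.+ q ∸ j))) ⟩
  Σℕ (2 ℕ.+ q) (λ j → below j n ℕ.* baseCoeff n (suc q ∸ j))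
    ≡⟨ Σℕ-dropLast (suc q) {λ j → below j n ℕ.* baseCoeff n (suc q ∸ j)} lastTerm ⟩
  Σℕ (suc q) (λ j → below j n ℕ.* baseCoeff n (suc q ∸ j))
    ≡⟨ Σℕ-cong (suc q) (λ j j<1+q →
         cong (λ x → below j n ℕ.* baseCoeff n x) (ℕP.+-∸-assoc 1 (ℕP.≤-pred j<1+q))) ⟩
  pairCount n q ∎
  where
  open ≡-Reasoning
  B = basePoly n
  -- the pair (q+1, 0) is excluded since exponents start at 1
  lastTerm : below (suc q) n ℕ.* baseCoeff n (suc q ∸ suc q) ≡ 0
  lastTerm = trans (cong (λ x → below (suc q) n ℕ.* baseCoeff n x) (ℕP.n∸n≡0 q))
                   (ℕP.*-zeroʳ (below (suc q) n))

-- For q < n every split j + (q - j) of q is admissible.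
pairCount-low : ∀ n q → q < n → pairCount n q ≡ suc q
pairCount-low n q q<n =
  trans (cong (λ N → Σℕ N f) (sym (ℕP.+-identityʳ (suc q))))
        (Σℕ-window 0 (suc q) 0 (λ _ ()) admissible (λ _ ()))
  where
  f : ℕ → ℕ
  f j = below j n ℕ.* below (q ∸ j) n
  admissible : ∀ j → j < suc q → f j ≡ 1
  admissible j j<1+q = cong₂ ℕ._*_
    (below-1 (ℕP.≤-<-trans (ℕP.≤-pred j<1+q) q<n))
    (below-1 (ℕP.≤-<-trans (ℕP.m∸n≤m q j) q<n))

-- For q = m + i with n = m + 1, exactly the splits with i ≤ j ≤ m are
-- admissible.
pairCount-high : ∀ m i → i ≤ m → pairCount (suc m) (m ℕ.+ i) ≡ suc m ∸ i
pairCount-high m i i≤m =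
  trans (cong (λ N → Σℕ N f) (sym length))
        (Σℕ-window i r i secondTooBig admissible firstTooBig)
  where
  r = suc m ∸ i
  f : ℕ → ℕ
  f j = below j (suc m) ℕ.* below (m ℕ.+ i ∸ j) (suc m)
  i+r≡n : i ℕ.+ r ≡ suc m
  i+r≡n = ℕP.m+[n∸m]≡n (ℕP.m≤n⇒m≤1+n i≤m)
  length : i ℕ.+ (r ℕ.+ i) ≡ suc (m ℕ.+ i)
  length = trans (sym (ℕP.+-assoc i r i)) (cong (ℕ._+ i) i+r≡n)
  secondTooBig : ∀ j → j < i → f j ≡ 0
  secondTooBig j j<i = trans (cong (below j (suc m) ℕ.*_) (below-0 big))
                             (ℕP.*-zeroʳ (below j (suc m)))
    where
    big : suc m ≤ m ℕ.+ i ∸ j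
    big = ℕP.≤-trans (ℕP.≤-reflexive (ℕP.+-comm 1 m))
            (ℕP.≤-trans (ℕP.+-monoʳ-≤ m (ℕP.m<n⇒0<n∸m j<i))
              (ℕP.≤-reflexive (sym (ℕP.+-∸-assoc m (ℕP.<⇒≤ j<i)))))
  admissible : ∀ l → l < r → f (i ℕ.+ l) ≡ 1
  admissible l l<r = cong₂ ℕ._*_
    (below-1 (ℕP.<-≤-trans (ℕP.+-monoʳ-< i l<r) (ℕP.≤-reflexive i+r≡n)))
    (below-1 (s≤s (ℕP.≤-trans (ℕP.≤-reflexive rest) (ℕP.m∸n≤m m l))))
    where
    rest : m ℕ.+ i ∸ (i ℕ.+ l) ≡ m ∸ l
    rest = trans (cong (_∸ (i ℕ.+ l)) (ℕP.+-comm m i)) (ℕP.[m+n]∸[m+o]≡n∸o i m l)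
  firstTooBig : ∀ l → l < i → f (i ℕ.+ r ℕ.+ l) ≡ 0
  firstTooBig l _ =
    cong (ℕ._* below (m ℕ.+ i ∸ (i ℕ.+ r ℕ.+ l)) (suc m))
         (below-0 (ℕP.≤-trans (ℕP.m≤m+n (suc m) l)
                              (ℕP.≤-reflexive (cong (ℕ._+ l) (sym i+r≡n)))))

sum-cong : ∀ m {f g : ℕ → ℤ} → (∀ i → i < m → f i ≡ g i) → sumℤ m f ≡ sumℤ m g
sum-cong zero    h = refl
sum-cong (suc m) h =
  cong₂ _+_ (sum-cong m (λ i i<m → h i (ℕP.m<n⇒m<1+n i<m))) (h m (ℕP.n<1+n m))

sum-+ : ∀ m (f g : ℕ → ℤ) → sumℤ m (λ i → f i + g i) ≡ sumℤ m f + sumℤ m g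
sum-+ zero    f g = refl
sum-+ (suc m) f g =
  trans (cong (_+ (f m + g m)) (sum-+ m f g)) (swap (sumℤ m f) (sumℤ m g) (f m) (g m))
  where
  swap : ∀ a b c d → (a + b) + (c + d) ≡ (a + c) + (b + d)
  swap = solve-∀

sum-* : ∀ m c (f : ℕ → ℤ) → sumℤ m (λ i → c * f i) ≡ c * sumℤ m f
sum-* zero    c f = sym (ℤP.*-zeroʳ c)
sum-* (suc m) c f =
  trans (cong (_+ (c * f m)) (sum-* m c f)) (sym (ℤP.*-distribˡ-+ c _ _))

sum-const : ∀ m c → sumℤ m (λ _ → c) ≡ + m * c
sum-const zero    c = sym (ℤP.*-zeroˡ c)
sum-const (suc m) c = trans (cong (_+ c) (sum-const m c)) (addOne (+ m) c)
  where
  addOne : ∀ a c → a * c + c ≡ (+ 1 + a) * c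
  addOne = solve-∀

sum-split : ∀ a b f → sumℤ (a ℕ.+ b) f ≡ sumℤ a f + sumℤ b (λ i → f (a ℕ.+ i))
sum-split a zero    f =
  trans (cong (λ x → sumℤ x f) (ℕP.+-identityʳ a)) (sym (ℤP.+-identityʳ _))
sum-split a (suc b) f =
  trans (cong (λ x → sumℤ x f) (ℕP.+-suc a b))
    (trans (cong (_+ f (a ℕ.+ b)) (sum-split a b f))
           (ℤP.+-assoc (sumℤ a f) (sumℤ b (λ i → f (a ℕ.+ i))) (f (a ℕ.+ b))))

sum-cons : ∀ m f → sumℤ (suc m) f ≡ f 0 + sumℤ m (λ i → f (suc i))
sum-cons m f =
  trans (sum-split 1 m f) (cong (_+ sumℤ m (λ i → f (suc i))) (ℤP.+-identityˡ (f 0)))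

sum-reverse : ∀ m f → sumℤ m f ≡ sumℤ m (λ i → f (m ∸ suc i))
sum-reverse zero    f = refl
sum-reverse (suc m) f =
  trans (cong (_+ f m) (sum-reverse m f))
        (trans (ℤP.+-comm _ (f m)) (sym (sum-cons m (λ i → f (suc m ∸ suc i)))))

sum-shift : ∀ m f → f 0 ≡ + 0 → f m ≡ + 0 → sumℤ m f ≡ sumℤ m (λ i → f (suc i))
sum-shift zero    f _    _    = refl
sum-shift (suc m) f f0≡0 fm≡0 = begin
  sumℤ (suc m) f                      ≡⟨ sum-cons m f ⟩
  f 0 + sumℤ m (λ i → f (suc i))      ≡⟨ cong (_+ sumℤ m (λ i → f (suc i))) f0≡0 ⟩
  + 0 + sumℤ m (λ i → f (suc i))      ≡⟨ ℤP.+-identityˡ _ ⟩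
  sumℤ m (λ i → f (suc i))            ≡⟨ sym (ℤP.+-identityʳ _) ⟩
  sumℤ m (λ i → f (suc i)) + + 0      ≡⟨ cong (λ z → sumℤ m (λ i → f (suc i)) + z) (sym fm≡0) ⟩
  sumℤ (suc m) (λ i → f (suc i))      ∎
  where open ≡-Reasoning

sum-triangle : ∀ N (g : ℕ → ℤ) →
  sumℤ N (λ j → sumℤ (suc j) g) ≡ sumℤ N (λ t → (+ N - + t) * g t)
sum-triangle zero    g = refl
sum-triangle (suc N) g = begin
  sumℤ N (λ j → sumℤ (suc j) g) + sumℤ (suc N) g
    ≡⟨ cong (_+ sumℤ (suc N) g) (sum-triangle N g) ⟩
  sumℤ N (λ t → (+ N - + t) * g t) + (sumℤ N g + g N)
    ≡⟨ sym (ℤP.+-assoc (sumℤ N (λ t → (+ N - + t) * g t)) (sumℤ N g) (g N)) ⟩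
  (sumℤ N (λ t → (+ N - + t) * g t) + sumℤ N g) + g N
    ≡⟨ cong₂ _+_ (sym (sum-+ N _ _)) (sym (lastWeight (+ N) (g N))) ⟩
  sumℤ N (λ t → (+ N - + t) * g t + g t) + (+ suc N - + N) * g N
    ≡⟨ cong (_+ ((+ suc N - + N) * g N)) (sum-cong N (λ t _ → raise (+ N) (+ t) (g t))) ⟩
  sumℤ N (λ t → (+ suc N - + t) * g t) + (+ suc N - + N) * g N ∎
  where
  open ≡-Reasoning
  raise : ∀ a b c → (a - b) * c + c ≡ (+ 1 + a - b) * c
  raise = solve-∀
  lastWeight : ∀ a c → (+ 1 + a - a) * c ≡ c
  lastWeight = solve-∀

neg-pow-odd : ∀ x k → (- x) ^ (2 ℕ.* k ℕ.+ 1) ≡ - (x ^ (2 ℕ.* k ℕ.+ 1))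
neg-pow-odd x k = begin
  (- x) ^ (2 ℕ.* k ℕ.+ 1)         ≡⟨ ℤP.^-distribˡ-+-* (- x) (2 ℕ.* k) 1 ⟩
  (- x) ^ (2 ℕ.* k) * (- x) ^ 1   ≡⟨ cong (_* (- x) ^ 1) (sym (ℤP.^-*-assoc (- x) 2 k)) ⟩
  ((- x) ^ 2) ^ k * (- x) ^ 1     ≡⟨ cong (λ y → y ^ k * (- x) ^ 1) (negSquare x) ⟩
  (x ^ 2) ^ k * (- x) ^ 1         ≡⟨ cong (_* (- x) ^ 1) (ℤP.^-*-assoc x 2 k) ⟩
  x ^ (2 ℕ.* k) * (- x) ^ 1       ≡⟨ pullNeg (x ^ (2 ℕ.* k)) x ⟩
  - (x ^ (2 ℕ.* k) * x ^ 1)       ≡⟨ cong -_ (sym (ℤP.^-distribˡ-+-* x (2 ℕ.* k) 1)) ⟩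
  - (x ^ (2 ℕ.* k ℕ.+ 1))         ∎
  where
  open ≡-Reasoning
  negSquare : ∀ x → (- x) * ((- x) * + 1) ≡ x * (x * + 1)
  negSquare = solve-∀
  pullNeg : ∀ a x → a * ((- x) * + 1) ≡ - (a * (x * + 1))
  pullNeg = solve-∀

zero-pow-odd : ∀ k → (+ 0) ^ (2 ℕ.* k ℕ.+ 1) ≡ + 0
zero-pow-odd k =
  trans (ℤP.^-distribˡ-+-* (+ 0) (2 ℕ.* k) 1) (ℤP.*-zeroʳ ((+ 0) ^ (2 ℕ.* k)))

module NormalForm (k m : ℕ) where

  e : ℕ
  e = 2 ℕ.* k ℕ.+ 1

  n : ℕ
  n = suc m

  P : ℕ → ℤ
  P t = (+ t) ^ e

  normalForm : ℤ
  normalForm = sumℤ n (λ i →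
    (+ (2 ℕ.* n ℕ.+ 2) + + i) * P (suc i) + (+ n - + i) * P (suc (n ℕ.+ i)))

  twice : 2 ℕ.* n ≡ n ℕ.+ n
  twice = cong (n ℕ.+_) (ℕP.+-identityʳ n)

  ∸⇒- : ∀ a b → b ≤ a → + (a ∸ b) ≡ + a - + b
  ∸⇒- a b b≤a = sym (trans (ℤP.m-n≡m⊖n a b) (ℤP.⊖-≥ b≤a))

  -- Reversing j ↦ n-1-i turns (j+1)(j+1-n)^e into (n-i)(-i)^e; after
  -- shifting i by one this is -(n-1-i) P(i+1).
  lowerHalf : sumℤ n (λ j → + suc j * (+ suc j - + n) ^ e)
            ≡ sumℤ n (λ i → (+ n - + suc i) * - P (suc i))
  lowerHalf = begin
    sumℤ n (λ j → + suc j * (+ suc j - + n) ^ e)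
      ≡⟨ sum-reverse n _ ⟩
    sumℤ n (λ i → + suc (n ∸ suc i) * (+ suc (n ∸ suc i) - + n) ^ e)
      ≡⟨ sum-cong n reflected ⟩
    sumℤ n (λ i → (+ n - + i) * - P i)
      ≡⟨ sum-shift n (λ i → (+ n - + i) * - P i) firstTerm (cancel (+ n) (- P n)) ⟩
    sumℤ n (λ i → (+ n - + suc i) * - P (suc i)) ∎
    where
    open ≡-Reasoning
    cancel : ∀ a b → (a - a) * b ≡ + 0
    cancel = solve-∀
    shiftBack : ∀ a b → (a - b) - a ≡ - b
    shiftBack = solve-∀
    firstTerm : (+ n - + 0) * - P 0 ≡ + 0
    firstTerm = trans (cong (λ z → (+ n - + 0) * - z) (zero-pow-odd k))
                      (ℤP.*-zeroʳ (+ n - + 0))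
    reflected : ∀ i → i < n →
      + suc (n ∸ suc i) * (+ suc (n ∸ suc i) - + n) ^ e ≡ (+ n - + i) * - P i
    reflected i i<n = begin
      + suc (n ∸ suc i) * (+ suc (n ∸ suc i) - + n) ^ e
        ≡⟨ cong (λ z → + z * (+ z - + n) ^ e) (sym (ℕP.+-∸-assoc 1 i<n)) ⟩
      + (n ∸ i) * (+ (n ∸ i) - + n) ^ e
        ≡⟨ cong (λ z → z * (z - + n) ^ e) (∸⇒- n i (ℕP.<⇒≤ i<n)) ⟩
      (+ n - + i) * ((+ n - + i) - + n) ^ e
        ≡⟨ cong (λ z → (+ n - + i) * z ^ e) (shiftBack (+ n) (+ i)) ⟩
      (+ n - + i) * (- + i) ^ e
        ≡⟨ cong ((+ n - + i) *_) (neg-pow-odd (+ i) k) ⟩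
      (+ n - + i) * - P i ∎

  upperHalf : sumℤ n (λ i → + suc (n ℕ.+ i) * (+ suc (n ℕ.+ i) - + n) ^ e)
            ≡ sumℤ n (λ i → + suc (n ℕ.+ i) * P (suc i))
  upperHalf = sum-cong n (λ i _ → cong (λ z → + suc (n ℕ.+ i) * z ^ e) (unshift (+ n) (+ i)))
    where
    unshift : ∀ a b → (+ 1 + (a + b)) - a ≡ + 1 + b
    unshift = solve-∀

  S̃₂≡normalForm : S̃₂ k n ≡ normalForm
  S̃₂≡normalForm = begin
    S̃₂ k n
      ≡⟨ sum-cong (2 ℕ.* n) (λ j _ → trans (sum-+ (suc j) (λ i → P (suc i)) (λ _ → Q j))
                                           (cong (λ z → sumℤ (suc j) (λ i → P (suc i)) + z)
                                                 (sum-const (suc j) (Q j)))) ⟩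
    sumℤ (2 ℕ.* n) (λ j → sumℤ (suc j) (λ i → P (suc i)) + + suc j * Q j)
      ≡⟨ sum-+ (2 ℕ.* n) _ _ ⟩
    sumℤ (2 ℕ.* n) (λ j → sumℤ (suc j) (λ i → P (suc i))) + sumℤ (2 ℕ.* n) (λ j → + suc j * Q j)
      ≡⟨ cong₂ _+_ (sum-triangle (2 ℕ.* n) (λ i → P (suc i)))
                   (cong (λ N → sumℤ N (λ j → + suc j * Q j)) twice) ⟩
    sumℤ (2 ℕ.* n) triangle + sumℤ (n ℕ.+ n) (λ j → + suc j * Q j)
      ≡⟨ cong₂ _+_ (trans (cong (λ N → sumℤ N triangle) twice) (sum-split n n triangle))
                   (sum-split n n _) ⟩
    (sumℤ n triangle + sumℤ n (λ i → triangle (n ℕ.+ i)))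
      + (sumℤ n (λ j → + suc j * Q j) + sumℤ n (λ i → + suc (n ℕ.+ i) * Q (n ℕ.+ i)))
      ≡⟨ cong₂ _+_ (sym (sum-+ n _ _)) (trans (cong₂ _+_ lowerHalf upperHalf) (sym (sum-+ n _ _))) ⟩
    sumℤ n (λ i → triangle i + triangle (n ℕ.+ i))
      + sumℤ n (λ i → (+ n - + suc i) * - P (suc i) + + suc (n ℕ.+ i) * P (suc i))
      ≡⟨ sym (sum-+ n _ _) ⟩
    sumℤ n (λ i → (triangle i + triangle (n ℕ.+ i))
                   + ((+ n - + suc i) * - P (suc i) + + suc (n ℕ.+ i) * P (suc i)))
      ≡⟨ sum-cong n (λ i _ → collect (+ m) (+ i) (P (suc i)) (P (suc (n ℕ.+ i)))) ⟩
    normalForm ∎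
    where
    open ≡-Reasoning
    Q : ℕ → ℤ
    Q j = (+ suc j - + n) ^ e
    triangle : ℕ → ℤ
    triangle t = (+ (2 ℕ.* n) - + t) * P (suc t)
    collect : ∀ a b u v →
      ((+ 1 + a + (+ 1 + a + + 0)) - b) * u + ((+ 1 + a + (+ 1 + a + + 0)) - (+ 1 + a + b)) * v
        + ((+ 1 + a - (+ 1 + b)) * (- u) + (+ 1 + (+ 1 + a + b)) * u)
      ≡ ((+ 1 + a + (+ 1 + a + + 0) + + 2) + b) * u + ((+ 1 + a) - b) * v
    collect = solve-∀

  -- Coefficient of P(t+1) in s₂: C₂(n, t-1), and 0 for t = 0.
  weight : ℕ → ℕ
  weight zero    = 0
  weight (suc q) = C₂ n q

  weight-low : ∀ i → i < n → weight i ≡ i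
  weight-low zero    _     = refl
  weight-low (suc q) 1+q<n =
    trans (C₂≡pairCount n q) (pairCount-low n q (ℕP.<-trans (ℕP.n<1+n q) 1+q<n))

  weight-high : ∀ i → i < n → + weight (n ℕ.+ i) ≡ + n - + i
  weight-high i i<n =
    trans (cong +_ (trans (C₂≡pairCount n (m ℕ.+ i)) (pairCount-high m i (ℕP.≤-pred i<n))))
          (∸⇒- n i (ℕP.<⇒≤ i<n))

  s₂-split : s₂ k n ≡ sumℤ n (λ i → + i * P (suc i))
                    + sumℤ n (λ i → (+ n - + i) * P (suc (n ℕ.+ i)))
  s₂-split = begin
    s₂ k n
      ≡⟨ sum-cong (2 ℕ.* n ∸ 1) (λ q _ → cong (λ z → + C₂ n q * (+ z) ^ e) (ℕP.+-comm q 2)) ⟩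
    sumℤ (2 ℕ.* n ∸ 1) (λ q → G (suc q))
      ≡⟨ sym (ℤP.+-identityˡ _) ⟩
    G 0 + sumℤ (2 ℕ.* n ∸ 1) (λ q → G (suc q))
      ≡⟨ sym (sum-cons (2 ℕ.* n ∸ 1) G) ⟩
    sumℤ (2 ℕ.* n) G
      ≡⟨ trans (cong (λ N → sumℤ N G) twice) (sum-split n n G) ⟩
    sumℤ n G + sumℤ n (λ i → G (n ℕ.+ i))
      ≡⟨ cong₂ _+_ (sum-cong n (λ i i<n → cong (λ z → + z * P (suc i)) (weight-low i i<n)))
                   (sum-cong n (λ i i<n → cong (_* P (suc (n ℕ.+ i))) (weight-high i i<n))) ⟩
    sumℤ n (λ i → + i * P (suc i)) + sumℤ n (λ i → (+ n - + i) * P (suc (n ℕ.+ i))) ∎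
    where
    open ≡-Reasoning
    G : ℕ → ℤ
    G t = + weight t * P (suc t)

  -- binom(2(n+1),1) s₁ adds 2(n+1) to the weight i of P(i+1).
  S₂≡normalForm : S₂ k n ≡ normalForm
  S₂≡normalForm = begin
    s₂ k n + + ((2 ℕ.* (n ℕ.+ 1)) C 1) * s₁ k n
      ≡⟨ cong₂ _+_ s₂-split (trans (cong (λ z → + z * s₁ k n) (nC1≡n (2 ℕ.* (n ℕ.+ 1))))
                                   (sym (sum-* n (+ (2 ℕ.* (n ℕ.+ 1))) (λ i → P (suc i))))) ⟩
    (sumℤ n (λ i → + i * P (suc i)) + sumℤ n (λ i → (+ n - + i) * P (suc (n ℕ.+ i))))
      + sumℤ n (λ i → + (2 ℕ.* (n ℕ.+ 1)) * P (suc i))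
      ≡⟨ cong (_+ sumℤ n (λ i → + (2 ℕ.* (n ℕ.+ 1)) * P (suc i))) (sym (sum-+ n _ _)) ⟩
    sumℤ n (λ i → + i * P (suc i) + (+ n - + i) * P (suc (n ℕ.+ i)))
      + sumℤ n (λ i → + (2 ℕ.* (n ℕ.+ 1)) * P (suc i))
      ≡⟨ sym (sum-+ n _ _) ⟩
    sumℤ n (λ i → (+ i * P (suc i) + (+ n - + i) * P (suc (n ℕ.+ i)))
                  + + (2 ℕ.* (n ℕ.+ 1)) * P (suc i))
      ≡⟨ sum-cong n (λ i _ → collect (+ m) (+ i) (P (suc i)) (P (suc (n ℕ.+ i)))) ⟩
    normalForm ∎
    where
    open ≡-Reasoning
    collect : ∀ a b u v →
      (b * u + ((+ 1 + a) - b) * v) + (((+ 1 + a) + + 1) + (((+ 1 + a) + + 1) + + 0)) * u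
      ≡ ((+ 1 + a + (+ 1 + a + + 0) + + 2) + b) * u + ((+ 1 + a) - b) * v
    collect = solve-∀

mainTheorem1 : (k n : ℕ) → n ≥ 1 → S̃₂ k n ≡ S₂ k n
mainTheorem1 k (suc m) _ = trans S̃₂≡normalForm (sym S₂≡normalForm)
  where open NormalForm k m
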